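{- Let $n,m\ge 0$ be integers. The algebra $\langle[-n,m];\Rightarrow,0\rangle$ is an $\mathbf{I}_{2,0}$-chain, and its order $\sqsubseteq$ is $-n\sqsubset -n+1\sqsubset\cdots\sqsubset -1\sqsubset 0\sqsubset 1\sqsubset\cdots\sqsubset m$ (i.e. it coincides with the usual order of integers).
   Context: A zroupoid is an algebra $\langle A,\to,0\rangle$ with binary $\to$ and constant $0$; $x':=x\to 0$. An implication zroupoid satisfies (I) $(x\to y)\to z\approx[(z'\to x)\to(y\to z)']'$ and $0''\approx 0$; $\mathbf{I}_{2,0}$ is the variety of implication zroupoids satisfying $x''\approx x$. Define $x\sqsubseteq y$ iff $(x\to y')'=x$; $x\sqsubset y$ means $x\sqsubseteq y$ and $x\neq y$. An $\mathbf{I}_{2,0}$-chain is a member of $\mathbf{I}_{2,0}$ on which $\sqsubseteq$ is total. Construction: $[-n,m]=\{x\in\mathbb Z:-n\le x\le m\}$; $p(x)=x-1$ if $x>-n$, $p(-n)=-n$; $0^\ast=m$, $x^\ast=x$ for $x<0$, $x^\ast=p((p(x))^\ast)$ for $x>0$; $x\Rightarrow y=\max(x^\ast,y)$ if $x,y\ge0$ and $\min(x,y)$ otherwise; the constant is $0$. -}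

module Defs where

open import Data.Nat using (ℕ; zero; suc)
open import Data.Integer using (ℤ; +_; -[1+_]; -_; _-_; _≤_; _<_; _⊔_; _⊓_)
open import Data.Integer.Properties using (_<?_)
open import Data.Product using (_×_)
open import Relation.Binary.PropositionalEquality using (_≡_)
open import Relation.Nullary using (yes; no)

InInterval : ℕ → ℕ → ℤ → Set
InInterval n m x = (- (+ n) ≤ x) × (x ≤ + m)

-- p(x) = x - 1 if x > -n, and p(-n) = -n (on [-n,m]; values below -n are
-- never used).
pr : ℕ → ℤ → ℤ
pr n x with (- (+ n)) <? x
... | yes _ = x - + 1
... | no  _ = - (+ n)

-- x* : 0* = m, x* = x for x < 0, x* = p((p x)*) for x > 0.
-- For x = k+1 > 0 we have x > -n, so p(x) = k; this is used to make the
-- recursion structural.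
star : ℕ → ℕ → ℤ → ℤ
star n m (+ zero)    = + m
star n m (+ suc k)   = pr n (star n m (+ k))
star n m -[1+ k ]    = -[1+ k ]

imp : ℕ → ℕ → ℤ → ℤ → ℤ
imp n m (+ a) (+ b) = star n m (+ a) ⊔ (+ b)
imp n m x y         = x ⊓ y

neg : ℕ → ℕ → ℤ → ℤ
neg n m x = imp n m x (+ 0)

⊑ : ℕ → ℕ → ℤ → ℤ → Set
⊑ n m x y = neg n m (imp n m x (neg n m y)) ≡ x

-- On the interval, the star operation of the construction is the
-- reflection a ↦ m ∸ a of [0,m]: p lowers a positive value by one, so the
-- recursion x* = p((p x)*) counts down from 0* = m.  Hence ⇒ agrees on
-- [-n,m] with the simpler model operation imp′:
--   • on [0,m] it is a ⇒ b = (m ∸ a) ⊔ b, a Kleene-style implication for the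
--     order-reversing involution a ↦ m ∸ a (module Positive), and
--   • as soon as a negative argument occurs it is the minimum.  Then every clause of the theorem is
-- checked for imp′ by cases on the signs: the positive cases reduce to
-- De Morgan, distributivity and involutivity in ℕ, the mixed/negative cases to
-- semilattice laws of ⊔ on ℕ (discharged by the idempotent commutative monoid
-- solver).
module Submission where

open import Level using (0ℓ)
open import Algebra.Bundles using (IdempotentCommutativeMonoid)
import Algebra.Solver.IdempotentCommutativeMonoid as ICM-Solver
open import Data.Nat as ℕ using (ℕ; zero; suc; _∸_; _⊔_; _⊓_; z≤n)
open import Data.Nat.Properties
  using (⊔-identityʳ; ⊔-comm; ⊔-idem; ⊔-lub; ⊔-distribˡ-⊓; ⊔-0-isCommutativeMonoid;
         m∸n≤m; m∸[m∸n]≡n; ∸-distribˡ-⊔-⊓; +-∸-assoc; <⇒≤)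
open import Data.Integer as ℤ using (ℤ; +_; -[1+_]; +≤+)
import Data.Integer.Properties as ℤP
open ℤP using (neg-≤-pos; ⊓-glb; i≤j⇒i⊓k≤j; i⊓j≡i⇒i≤j; i≤j⇒i⊓j≡i)
open import Data.Product using (_×_; _,_; proj₁; proj₂)
open import Data.Sum using (_⊎_; inj₁; inj₂)
open import Relation.Binary.PropositionalEquality
open ≡-Reasoning
open import Defs

module Positive (m : ℕ) where

  infixr 5 _⇒_
  _⇒_ : ℕ → ℕ → ℕ
  a ⇒ b = (m ∸ a) ⊔ b

  _′ : ℕ → ℕ
  a ′ = a ⇒ 0

  ′-reflects : ∀ a → a ′ ≡ m ∸ a
  ′-reflects a = ⊔-identityʳ (m ∸ a)

  ∸-′-cancel : ∀ {a} → a ℕ.≤ m → m ∸ a ′ ≡ a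
  ∸-′-cancel {a} a≤m = trans (cong (m ∸_) (′-reflects a)) (m∸[m∸n]≡n a≤m)

  ′-involutive : ∀ {a} → a ℕ.≤ m → a ′ ′ ≡ a
  ′-involutive {a} a≤m = trans (′-reflects (a ′)) (∸-′-cancel a≤m)

  identity-I-lhs-normal : ∀ {a} b c → a ℕ.≤ m → (a ⇒ b) ⇒ c ≡ c ⊔ (a ⊓ (m ∸ b))
  identity-I-lhs-normal {a} b c a≤m = begin
    (m ∸ ((m ∸ a) ⊔ b)) ⊔ c            ≡⟨ cong (_⊔ c) (∸-distribˡ-⊔-⊓ m (m ∸ a) b) ⟩
    ((m ∸ (m ∸ a)) ⊓ (m ∸ b)) ⊔ c      ≡⟨ cong (λ t → (t ⊓ (m ∸ b)) ⊔ c) (m∸[m∸n]≡n a≤m) ⟩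
    (a ⊓ (m ∸ b)) ⊔ c                  ≡⟨ ⊔-comm _ c ⟩
    c ⊔ (a ⊓ (m ∸ b))                  ∎

  identity-I-rhs-normal : ∀ {a c} b → a ℕ.≤ m → c ℕ.≤ m →
    ((c ′ ⇒ a) ⇒ (b ⇒ c) ′) ′ ≡ (c ⊔ a) ⊓ (c ⊔ (m ∸ b))
  identity-I-rhs-normal {a} {c} b a≤m c≤m = begin
    ((c ′ ⇒ a) ⇒ (b ⇒ c) ′) ′               ≡⟨ ′-reflects ((c ′ ⇒ a) ⇒ (b ⇒ c) ′) ⟩
    m ∸ ((m ∸ (c ′ ⇒ a)) ⊔ (b ⇒ c) ′)       ≡⟨ cong (λ t → m ∸ ((m ∸ (c ′ ⇒ a)) ⊔ t)) (′-reflects (b ⇒ c)) ⟩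
    m ∸ ((m ∸ (c ′ ⇒ a)) ⊔ (m ∸ (b ⇒ c)))   ≡⟨ ∸-distribˡ-⊔-⊓ m (m ∸ (c ′ ⇒ a)) (m ∸ (b ⇒ c)) ⟩
    (m ∸ (m ∸ (c ′ ⇒ a))) ⊓ (m ∸ (m ∸ (b ⇒ c)))
      ≡⟨ cong₂ _⊓_ (m∸[m∸n]≡n (⇒-bounded (c ′) a≤m)) (m∸[m∸n]≡n (⇒-bounded b c≤m)) ⟩
    (c ′ ⇒ a) ⊓ (b ⇒ c)                     ≡⟨ cong (λ t → (t ⊔ a) ⊓ (b ⇒ c)) (∸-′-cancel c≤m) ⟩
    (c ⊔ a) ⊓ ((m ∸ b) ⊔ c)                 ≡⟨ cong ((c ⊔ a) ⊓_) (⊔-comm (m ∸ b) c) ⟩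
    (c ⊔ a) ⊓ (c ⊔ (m ∸ b))                 ∎
    where
    ⇒-bounded : ∀ {b} a → b ℕ.≤ m → a ⇒ b ℕ.≤ m
    ⇒-bounded a b≤m = ⊔-lub (m∸n≤m m a) b≤m

  identity-I-positive : ∀ {a b c} → a ℕ.≤ m → c ℕ.≤ m →
    (a ⇒ b) ⇒ c ≡ ((c ′ ⇒ a) ⇒ (b ⇒ c) ′) ′
  identity-I-positive {a} {b} {c} a≤m c≤m = begin
    (a ⇒ b) ⇒ c                   ≡⟨ identity-I-lhs-normal b c a≤m ⟩
    c ⊔ (a ⊓ (m ∸ b))             ≡⟨ ⊔-distribˡ-⊓ c a (m ∸ b) ⟩
    (c ⊔ a) ⊓ (c ⊔ (m ∸ b))       ≡⟨ sym (identity-I-rhs-normal b a≤m c≤m) ⟩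
    ((c ′ ⇒ a) ⇒ (b ⇒ c) ′) ′     ∎

  meet-via-⇒ : ∀ {a b} → a ℕ.≤ m → b ℕ.≤ m → (a ⇒ b ′) ′ ≡ a ⊓ b
  meet-via-⇒ {a} {b} a≤m b≤m = begin
    (a ⇒ b ′) ′                     ≡⟨ ′-reflects (a ⇒ b ′) ⟩
    m ∸ ((m ∸ a) ⊔ b ′)             ≡⟨ cong (λ t → m ∸ ((m ∸ a) ⊔ t)) (′-reflects b) ⟩
    m ∸ ((m ∸ a) ⊔ (m ∸ b))         ≡⟨ ∸-distribˡ-⊔-⊓ m (m ∸ a) (m ∸ b) ⟩
    (m ∸ (m ∸ a)) ⊓ (m ∸ (m ∸ b))   ≡⟨ cong₂ _⊓_ (m∸[m∸n]≡n a≤m) (m∸[m∸n]≡n b≤m) ⟩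
    a ⊓ b                           ∎

-- p(k+1) = k: a positive element always lies above -n.
pr-suc : ∀ n k → pr n (+ suc k) ≡ + k
pr-suc zero    k = refl
pr-suc (suc n) k = refl

star-reflects : ∀ n m {a} → a ℕ.≤ m → star n m (+ a) ≡ + (m ∸ a)
star-reflects n m {zero}  _    = refl
star-reflects n m {suc a} a<m = begin
  pr n (star n m (+ a))    ≡⟨ cong (pr n) (star-reflects n m (<⇒≤ a<m)) ⟩
  pr n (+ (m ∸ a))         ≡⟨ cong (λ t → pr n (+ t)) (+-∸-assoc 1 a<m) ⟩
  pr n (+ suc (m ∸ suc a)) ≡⟨ pr-suc n (m ∸ suc a) ⟩
  + (m ∸ suc a)            ∎

-- The semilattice (ℕ, ⊔, 0), used to normalise the cases with a negative
-- argument, where ⇒ is the minimum of ℤ, i.e. ⊔ on the magnitudes.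
⊔-0-idempotentCommutativeMonoid : IdempotentCommutativeMonoid 0ℓ 0ℓ
⊔-0-idempotentCommutativeMonoid = record
  { isIdempotentCommutativeMonoid = record
    { isCommutativeMonoid = ⊔-0-isCommutativeMonoid
    ; idem                = ⊔-idem
    }
  }

open ICM-Solver ⊔-0-idempotentCommutativeMonoid using (solve; _⊜_; _⊕_)

module OnInterval (n m : ℕ) where

  open Positive m

  In : ℤ → Set
  In = InInterval n m

  imp′ : ℤ → ℤ → ℤ
  imp′ (+ a) (+ b) = + (a ⇒ b)
  imp′ x     y     = x ℤ.⊓ y

  neg′ : ℤ → ℤ
  neg′ x = imp′ x (+ 0)

  bound : ∀ {a} → In (+ a) → a ℕ.≤ m
  bound (_ , +≤+ a≤m) = a≤m

  positive-in : ∀ {a} → a ℕ.≤ m → In (+ a)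
  positive-in a≤m = neg-≤-pos , +≤+ a≤m

  ⊓-closed : ∀ {x y} → In x → In y → In (x ℤ.⊓ y)
  ⊓-closed {x} {y} (-n≤x , x≤m) (-n≤y , _) = ⊓-glb -n≤x -n≤y , i≤j⇒i⊓k≤j y x≤m

  imp′-closed : ∀ {x y} → In x → In y → In (imp′ x y)
  imp′-closed {+ a}    {+ b}    _  iy = positive-in (⊔-lub (m∸n≤m m a) (bound iy))
  imp′-closed {+ a}    { -[1+ b ]} ix iy = ⊓-closed ix iy
  imp′-closed { -[1+ a ]} {y}   ix iy = ⊓-closed ix iy

  imp-agrees : ∀ {x} y → In x → imp n m x y ≡ imp′ x y
  imp-agrees {+ a}    (+ b)    ix = cong (ℤ._⊔ + b) (star-reflects n m (bound ix))
  imp-agrees {+ a}    -[1+ b ] _  = refl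
  imp-agrees { -[1+ a ]} y     _  = refl

  -- Tracks x x′: x equals its model value x′, which lies in the interval.
  -- Tracking is preserved by ⇒, so whole terms can be evaluated in the model.
  Tracks : ℤ → ℤ → Set
  Tracks x x′ = x ≡ x′ × In x′

  tracks : ∀ {x} → In x → Tracks x x
  tracks ix = refl , ix

  imp-tracks : ∀ {x x′ y y′} → Tracks x x′ → Tracks y y′ → Tracks (imp n m x y) (imp′ x′ y′)
  imp-tracks {y′ = y′} (refl , ix) (refl , iy) = imp-agrees y′ ix , imp′-closed ix iy

  neg-tracks : ∀ {x x′} → Tracks x x′ → Tracks (neg n m x) (neg′ x′)
  neg-tracks t = imp-tracks t (tracks (positive-in z≤n))

  tracked-in : ∀ {x x′} → Tracks x x′ → In x
  tracked-in (refl , ix′) = ix′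

  tracked-≡ : ∀ {x x′ y y′} → Tracks x x′ → Tracks y y′ → x′ ≡ y′ → x ≡ y
  tracked-≡ (refl , _) (refl , _) x′≡y′ = x′≡y′

  identity-I′ : ∀ x y z → In x → In z →
    imp′ (imp′ x y) z ≡ neg′ (imp′ (imp′ (neg′ z) x) (neg′ (imp′ y z)))
  identity-I′ (+ a)    (+ b)    (+ c)    ix iz = cong +_ (identity-I-positive (bound ix) (bound iz))
  identity-I′ (+ a)    (+ b)    -[1+ c ] _  _  = cong -[1+_] (solve 1 (λ c → c ⊜ c ⊕ c) refl c)
  identity-I′ (+ a)    -[1+ b ] (+ c)    _  _  = refl
  identity-I′ (+ a)    -[1+ b ] -[1+ c ] _  _  = cong -[1+_] (solve 2 (λ b c → b ⊕ c ⊜ c ⊕ (b ⊕ c)) refl b c)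
  identity-I′ -[1+ a ] (+ b)    (+ c)    _  _  = refl
  identity-I′ -[1+ a ] (+ b)    -[1+ c ] _  _  = cong -[1+_] (solve 2 (λ a c → a ⊕ c ⊜ (c ⊕ a) ⊕ c) refl a c)
  identity-I′ -[1+ a ] -[1+ b ] (+ c)    _  _  = refl
  identity-I′ -[1+ a ] -[1+ b ] -[1+ c ] _  _  =
    cong -[1+_] (solve 3 (λ a b c → (a ⊕ b) ⊕ c ⊜ (c ⊕ a) ⊕ (b ⊕ c)) refl a b c)

  neg′-involutive : ∀ {x} → In x → neg′ (neg′ x) ≡ x
  neg′-involutive {+ a}    ix = cong +_ (′-involutive (bound ix))
  neg′-involutive { -[1+ a ]} _  = refl

  meet-via-imp′ : ∀ {x y} → In x → In y → neg′ (imp′ x (neg′ y)) ≡ x ℤ.⊓ y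
  meet-via-imp′ {+ a}    {+ b}    ix iy = cong +_ (meet-via-⇒ (bound ix) (bound iy))
  meet-via-imp′ {+ a}    { -[1+ b ]} _  _  = refl
  meet-via-imp′ { -[1+ a ]} {+ b}    _  _  = refl
  meet-via-imp′ { -[1+ a ]} { -[1+ b ]} _  _  = refl

  closed : ∀ {x y} → In x → In y → In (imp n m x y)
  closed ix iy = tracked-in (imp-tracks (tracks ix) (tracks iy))

  identity-I : ∀ {x y z} → In x → In y → In z →
    imp n m (imp n m x y) z ≡ neg n m (imp n m (imp n m (neg n m z) x) (neg n m (imp n m y z)))
  identity-I {x} {y} {z} ix iy iz =
    tracked-≡ (imp-tracks (imp-tracks (tracks ix) (tracks iy)) (tracks iz))
              (neg-tracks (imp-tracks (imp-tracks (neg-tracks (tracks iz)) (tracks ix))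
                                      (neg-tracks (imp-tracks (tracks iy) (tracks iz)))))
              (identity-I′ x y z ix iz)

  involutive : ∀ {x} → In x → neg n m (neg n m x) ≡ x
  involutive ix = tracked-≡ (neg-tracks (neg-tracks (tracks ix))) (tracks ix) (neg′-involutive ix)

  ⊑-iff-≤ : ∀ {x y} → In x → In y → (⊑ n m x y → x ℤ.≤ y) × (x ℤ.≤ y → ⊑ n m x y)
  ⊑-iff-≤ {x} {y} ix iy =
      (λ x⊑y → i⊓j≡i⇒i≤j (trans (sym ⊑-term-is-meet) x⊑y))
    , (λ x≤y → trans ⊑-term-is-meet (i≤j⇒i⊓j≡i x≤y))
    where
    ⊑-term-is-meet : neg n m (imp n m x (neg n m y)) ≡ x ℤ.⊓ y
    ⊑-term-is-meet = tracked-≡ (neg-tracks (imp-tracks (tracks ix) (neg-tracks (tracks iy))))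
                               (tracks (⊓-closed ix iy)) (meet-via-imp′ ix iy)

  chain : ∀ {x y} → In x → In y → ⊑ n m x y ⊎ ⊑ n m y x
  chain {x} {y} ix iy with ℤP.≤-total x y
  ... | inj₁ x≤y = inj₁ (proj₂ (⊑-iff-≤ ix iy) x≤y)
  ... | inj₂ y≤x = inj₂ (proj₂ (⊑-iff-≤ iy ix) y≤x)

theorem4p9 : (n m : ℕ) →
    ((x y : ℤ) → InInterval n m x → InInterval n m y → InInterval n m (imp n m x y))
    × ((x y z : ℤ) → InInterval n m x → InInterval n m y → InInterval n m z →
         imp n m (imp n m x y) z
           ≡ neg n m (imp n m (imp n m (neg n m z) x) (neg n m (imp n m y z))))
    × (neg n m (neg n m (+ 0)) ≡ + 0)
    × ((x : ℤ) → InInterval n m x → neg n m (neg n m x) ≡ x)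
    × ((x y : ℤ) → InInterval n m x → InInterval n m y → ⊑ n m x y ⊎ ⊑ n m y x)
    × ((x y : ℤ) → InInterval n m x → InInterval n m y →
         (⊑ n m x y → x ℤ.≤ y) × (x ℤ.≤ y → ⊑ n m x y))
theorem4p9 n m =
    (λ _ _ → closed)
  , (λ _ _ _ → identity-I)
  , involutive (positive-in z≤n)
  , (λ _ → involutive)
  , (λ _ _ → chain)
  , (λ _ _ → ⊑-iff-≤)
  where open OnInterval n m
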